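{- Let $h$, $n$, $p$ be integers with $0<h<n$ and $p\geq 0$. Then \[ \mathcal{N}_{n+ph}(h)=\mathcal{N}_n(h)+p\,\varphi(h). \]
   Context: For a positive integer $n$, the Farey sequence $F_n$ is the set of irreducible fractions $a/b$ with $0<a/b\leq 1$ and $1\leq b\leq n$ (the fraction $0/1$ is excluded, $1/1$ is included). $\mathcal{N}_n(h)$ denotes the number of fractions in $F_n$ whose (reduced) numerator equals $h$. $\varphi$ is Euler's totient function. -}

module Defs where

open import Data.Nat using (ℕ; suc; _≟_)
open import Data.Nat.Coprimality using (Coprime; coprime?)
open import Data.List using (List; length; filter; map; upTo; concatMap)
open import Data.Product using (_×_; _,_; proj₁; proj₂)

range1 : ℕ → List ℕ
range1 n = map suc (upTo n)

φ : ℕ → ℕ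
φ h = length (filter (λ k → coprime? k h) (range1 h))

-- The Farey sequence F_n as a list of (numerator, denominator) pairs (a , b)
-- of irreducible fractions a/b with 0 < a/b ≤ 1 and 1 ≤ b ≤ n,
-- i.e. 1 ≤ b ≤ n, 1 ≤ a ≤ b, gcd(a,b) = 1 (each fraction listed once,
-- in lowest terms).
Farey : ℕ → List (ℕ × ℕ)
Farey n = filter (λ ab → coprime? (proj₁ ab) (proj₂ ab))
            (concatMap (λ b → map (λ a → (a , b)) (range1 b)) (range1 n))

𝒩 : ℕ → ℕ → ℕ
𝒩 n h = length (filter (λ ab → proj₁ ab ≟ h) (Farey n))

-- Only the denominators b ≥ h contribute to 𝒩 n h, one fraction h/b for each b
-- coprime to h, so 𝒩 n h is a partial sum of the indicator of gcd(h, b) = 1.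
-- That indicator has period h, and every period contributes exactly φ(h).
module Submission where

open import Defs
open import Data.Nat using (ℕ; _+_; _*_; _<_)
open import Relation.Binary.PropositionalEquality using (_≡_)

open import Data.Bool using (Bool; true; false)
open import Data.List using (List; []; _∷_; _++_; [_]; map; filter; length; concatMap; upTo)
open import Data.List.Properties using (map-++; map-∘; upTo-∷ʳ)
open import Data.Nat.ListAction using (sum)
open import Data.Nat.ListAction.Properties using (sum-++)
open import Data.Nat using (zero; suc; _≤_; _≤′_; ≤′-refl; ≤′-step; _≟_; s≤s)
open import Data.Nat.Properties
open import Data.Nat.Coprimality using (Coprime; coprime?)
import Data.Nat.Coprimality as Coprime
open import Data.Nat.Divisibility using (_∣_; ∣m+n∣m⇒∣n; ∣m∣n⇒∣m+n)
open import Data.Product using (_×_; _,_; proj₁; proj₂)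
open import Function using (_∘_; _⇔_; mk⇔)
open import Relation.Nullary using (Dec; does)
open import Relation.Nullary.Decidable using (does-⇔; dec-true; dec-false)
open import Relation.Unary using (Pred; Decidable)
open import Relation.Binary.PropositionalEquality using (refl; sym; trans; cong; cong₂; subst; module ≡-Reasoning)
open ≡-Reasoning

𝟙 : Bool → ℕ
𝟙 true  = 1
𝟙 false = 0

sumTo : (ℕ → ℕ) → ℕ → ℕ
sumTo f zero    = 0
sumTo f (suc n) = sumTo f n + f (suc n)

module _ {a p} {A : Set a} {P : Pred A p} (P? : Decidable P) where

  length-filter : ∀ xs → length (filter P? xs) ≡ sum (map (𝟙 ∘ does ∘ P?) xs)
  length-filter []       = refl
  length-filter (x ∷ xs) with does (P? x)
  ... | true  = cong suc (length-filter xs)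
  ... | false = length-filter xs

  sum-map-filter : ∀ (f : A → ℕ) xs →
                   sum (map f (filter P? xs)) ≡ sum (map (λ x → 𝟙 (does (P? x)) * f x) xs)
  sum-map-filter f []       = refl
  sum-map-filter f (x ∷ xs) with does (P? x)
  ... | true  = cong₂ _+_ (sym (+-identityʳ (f x))) (sum-map-filter f xs)
  ... | false = sum-map-filter f xs

sum-map-concatMap : ∀ {a b} {A : Set a} {B : Set b} (f : B → ℕ) (g : A → List B) xs →
                    sum (map f (concatMap g xs)) ≡ sum (map (sum ∘ map f ∘ g) xs)
sum-map-concatMap f g []       = refl
sum-map-concatMap f g (x ∷ xs) = begin
  sum (map f (g x ++ concatMap g xs))            ≡⟨ cong sum (map-++ f (g x) (concatMap g xs)) ⟩
  sum (map f (g x) ++ map f (concatMap g xs))    ≡⟨ sum-++ (map f (g x)) (map f (concatMap g xs)) ⟩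
  sum (map f (g x)) + sum (map f (concatMap g xs)) ≡⟨ cong (sum (map f (g x)) +_) (sum-map-concatMap f g xs) ⟩
  sum (map f (g x)) + sum (map (sum ∘ map f ∘ g) xs) ∎

range1-suc : ∀ n → range1 (suc n) ≡ range1 n ++ [ suc n ]
range1-suc n = trans (cong (map suc) (sym (upTo-∷ʳ n))) (map-++ suc (upTo n) [ n ])

sum-map-range1 : ∀ f n → sum (map f (range1 n)) ≡ sumTo f n
sum-map-range1 f zero    = refl
sum-map-range1 f (suc n) = begin
  sum (map f (range1 (suc n)))                ≡⟨ cong (sum ∘ map f) (range1-suc n) ⟩
  sum (map f (range1 n ++ [ suc n ]))         ≡⟨ cong sum (map-++ f (range1 n) [ suc n ]) ⟩
  sum (map f (range1 n) ++ [ f (suc n) ])     ≡⟨ sum-++ (map f (range1 n)) [ f (suc n) ] ⟩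
  sum (map f (range1 n)) + (f (suc n) + 0)    ≡⟨ cong₂ _+_ (sum-map-range1 f n) (+-identityʳ (f (suc n))) ⟩
  sumTo f n + f (suc n)                       ∎

sumTo-cong : ∀ {f g} → (∀ b → f b ≡ g b) → ∀ n → sumTo f n ≡ sumTo g n
sumTo-cong f≗g zero    = refl
sumTo-cong f≗g (suc n) = cong₂ _+_ (sumTo-cong f≗g n) (f≗g (suc n))

sumTo-+ : ∀ f m k → sumTo f (m + k) ≡ sumTo f m + sumTo (λ b → f (m + b)) k
sumTo-+ f m zero    = trans (cong (sumTo f) (+-identityʳ m)) (sym (+-identityʳ (sumTo f m)))
sumTo-+ f m (suc k) = begin
  sumTo f (m + suc k)                                          ≡⟨ cong (sumTo f) (+-suc m k) ⟩
  sumTo f (m + k) + f (suc (m + k))                            ≡⟨ cong₂ _+_ (sumTo-+ f m k) (cong f (sym (+-suc m k))) ⟩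
  sumTo f m + sumTo (λ b → f (m + b)) k + f (m + suc k)        ≡⟨ +-assoc (sumTo f m) _ _ ⟩
  sumTo f m + sumTo (λ b → f (m + b)) (suc k)                  ∎

module _ {f : ℕ → ℕ} {h : ℕ} (periodic : ∀ b → f (b + h) ≡ f b) where

  sumTo-+-period : ∀ m → sumTo f (m + h) ≡ sumTo f m + sumTo f h
  sumTo-+-period zero    = refl
  sumTo-+-period (suc m) = begin
    sumTo f (m + h) + f (suc m + h)          ≡⟨ cong₂ _+_ (sumTo-+-period m) (periodic (suc m)) ⟩
    sumTo f m + sumTo f h + f (suc m)        ≡⟨ +-assoc (sumTo f m) _ _ ⟩
    sumTo f m + (sumTo f h + f (suc m))      ≡⟨ cong (sumTo f m +_) (+-comm (sumTo f h) _) ⟩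
    sumTo f m + (f (suc m) + sumTo f h)      ≡⟨ sym (+-assoc (sumTo f m) _ _) ⟩
    sumTo f (suc m) + sumTo f h              ∎

  sumTo-shift-period : ∀ m → sumTo (λ b → f (m + b)) h ≡ sumTo f h
  sumTo-shift-period m = +-cancelˡ-≡ (sumTo f m) _ _
    (trans (sym (sumTo-+ f m h)) (sumTo-+-period m))

module _ (f : ℕ → ℕ) {h : ℕ} where

  sumTo-*-𝟙≟-< : ∀ {m} → m < h → sumTo (λ a → f a * 𝟙 (does (a ≟ h))) m ≡ 0
  sumTo-*-𝟙≟-< {zero}  _     = refl
  sumTo-*-𝟙≟-< {suc m} 1+m<h = begin
    sumTo (λ a → f a * 𝟙 (does (a ≟ h))) m + f (suc m) * 𝟙 (does (suc m ≟ h))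
      ≡⟨ cong₂ _+_ (sumTo-*-𝟙≟-< (<-trans (n<1+n m) 1+m<h))
                   (cong (λ t → f (suc m) * 𝟙 t) (dec-false (suc m ≟ h) (<⇒≢ 1+m<h))) ⟩
    f (suc m) * 0
      ≡⟨ *-zeroʳ (f (suc m)) ⟩
    0 ∎

  sumTo-*-𝟙≟-≥ : ∀ {m} → 0 < h → h ≤′ m → sumTo (λ a → f a * 𝟙 (does (a ≟ h))) m ≡ f h
  sumTo-*-𝟙≟-≥ {suc k} _ ≤′-refl = begin
    sumTo (λ a → f a * 𝟙 (does (a ≟ suc k))) k + f (suc k) * 𝟙 (does (suc k ≟ suc k))
      ≡⟨ cong₂ _+_ (sumTo-*-𝟙≟-< (n<1+n k))
                   (cong (λ t → f (suc k) * 𝟙 t) (dec-true (suc k ≟ suc k) refl)) ⟩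
    f (suc k) * 1
      ≡⟨ *-identityʳ (f (suc k)) ⟩
    f (suc k) ∎
  sumTo-*-𝟙≟-≥ {suc m} 0<h (≤′-step h≤′m) = begin
    sumTo (λ a → f a * 𝟙 (does (a ≟ h))) m + f (suc m) * 𝟙 (does (suc m ≟ h))
      ≡⟨ cong₂ _+_ (sumTo-*-𝟙≟-≥ 0<h h≤′m)
                   (cong (λ t → f (suc m) * 𝟙 t)
                         (dec-false (suc m ≟ h) (<⇒≢ (s≤s (≤′⇒≤ h≤′m)) ∘ sym))) ⟩
    f h + f (suc m) * 0
      ≡⟨ cong (f h +_) (*-zeroʳ (f (suc m))) ⟩
    f h + 0
      ≡⟨ +-identityʳ (f h) ⟩
    f h ∎

coprime-+-self : ∀ h b → Coprime h (b + h) ⇔ Coprime h b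
coprime-+-self h b = mk⇔
  (λ c {d} (d∣h , d∣b) → c (d∣h , ∣m∣n⇒∣m+n d∣b d∣h))
  (λ c {d} (d∣h , d∣b+h) → c (d∣h , ∣m+n∣m⇒∣n (subst (d ∣_) (+-comm b h) d∣b+h) d∣h))

module _ (h : ℕ) where

  coprimeTo : ℕ → ℕ
  coprimeTo b = 𝟙 (does (coprime? h b))

  column : ℕ → ℕ
  column b = sumTo (λ a → 𝟙 (does (coprime? a b)) * 𝟙 (does (a ≟ h))) b

  φ≡sumTo-coprimeTo : φ h ≡ sumTo coprimeTo h
  φ≡sumTo-coprimeTo = begin
    φ h
      ≡⟨ length-filter (λ k → coprime? k h) (range1 h) ⟩
    sum (map (λ k → 𝟙 (does (coprime? k h))) (range1 h))
      ≡⟨ sum-map-range1 _ h ⟩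
    sumTo (λ k → 𝟙 (does (coprime? k h))) h
      ≡⟨ sumTo-cong (λ k → cong 𝟙 (does-⇔ (mk⇔ Coprime.sym Coprime.sym) (coprime? k h) (coprime? h k))) h ⟩
    sumTo coprimeTo h ∎

  𝒩≡sumTo-column : ∀ n → 𝒩 n h ≡ sumTo column n
  𝒩≡sumTo-column n = begin
    𝒩 n h
      ≡⟨ length-filter isH (filter cop (concatMap pairs (range1 n))) ⟩
    sum (map (𝟙 ∘ does ∘ isH) (filter cop (concatMap pairs (range1 n))))
      ≡⟨ sum-map-filter cop (𝟙 ∘ does ∘ isH) (concatMap pairs (range1 n)) ⟩
    sum (map weight (concatMap pairs (range1 n)))
      ≡⟨ sum-map-concatMap weight pairs (range1 n) ⟩
    sum (map (sum ∘ map weight ∘ pairs) (range1 n))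
      ≡⟨ sum-map-range1 _ n ⟩
    sumTo (sum ∘ map weight ∘ pairs) n
      ≡⟨ sumTo-cong (λ b → trans (cong sum (sym (map-∘ (range1 b)))) (sum-map-range1 _ b)) n ⟩
    sumTo column n ∎
    where
    cop : (ab : ℕ × ℕ) → Dec (Coprime (proj₁ ab) (proj₂ ab))
    cop ab = coprime? (proj₁ ab) (proj₂ ab)

    isH : (ab : ℕ × ℕ) → Dec (proj₁ ab ≡ h)
    isH ab = proj₁ ab ≟ h

    pairs : ℕ → List (ℕ × ℕ)
    pairs b = map (λ a → (a , b)) (range1 b)

    weight : ℕ × ℕ → ℕ
    weight ab = 𝟙 (does (cop ab)) * 𝟙 (does (isH ab))

  column≡coprimeTo : 0 < h → ∀ {b} → h ≤ b → column b ≡ coprimeTo b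
  column≡coprimeTo 0<h {b} h≤b =
    sumTo-*-𝟙≟-≥ (λ a → 𝟙 (does (coprime? a b))) 0<h (≤⇒≤′ h≤b)

  coprimeTo-periodic : ∀ b → coprimeTo (b + h) ≡ coprimeTo b
  coprimeTo-periodic b = cong 𝟙 (does-⇔ (coprime-+-self h b) (coprime? h (b + h)) (coprime? h b))

𝒩-+-period : ∀ {h n} → 0 < h → h ≤ n → 𝒩 (n + h) h ≡ 𝒩 n h + φ h
𝒩-+-period {h} {n} 0<h h≤n = begin
  𝒩 (n + h) h                                      ≡⟨ 𝒩≡sumTo-column h (n + h) ⟩
  sumTo (column h) (n + h)                         ≡⟨ sumTo-+ (column h) n h ⟩
  sumTo (column h) n + sumTo (λ b → column h (n + b)) h
    ≡⟨ cong₂ _+_ (sym (𝒩≡sumTo-column h n))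
                 (sumTo-cong (λ b → column≡coprimeTo h 0<h (≤-trans h≤n (m≤m+n n b))) h) ⟩
  𝒩 n h + sumTo (λ b → coprimeTo h (n + b)) h      ≡⟨ cong (𝒩 n h +_) (sumTo-shift-period (coprimeTo-periodic h) n) ⟩
  𝒩 n h + sumTo (coprimeTo h) h                    ≡⟨ cong (𝒩 n h +_) (sym (φ≡sumTo-coprimeTo h)) ⟩
  𝒩 n h + φ h                                      ∎

corollary2 : (h n p : ℕ) → 0 < h → h < n →
    𝒩 (n + p * h) h ≡ 𝒩 n h + p * φ h
corollary2 h n zero    _   _   = trans (cong (λ m → 𝒩 m h) (+-identityʳ n)) (sym (+-identityʳ (𝒩 n h)))
corollary2 h n (suc p) 0<h h<n = begin
  𝒩 (n + (h + p * h)) h      ≡⟨ cong (λ m → 𝒩 m h) (trans (cong (n +_) (+-comm h (p * h))) (sym (+-assoc n (p * h) h))) ⟩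
  𝒩 (n + p * h + h) h        ≡⟨ 𝒩-+-period 0<h (≤-trans (<⇒≤ h<n) (m≤m+n n (p * h))) ⟩
  𝒩 (n + p * h) h + φ h      ≡⟨ cong (_+ φ h) (corollary2 h n p 0<h h<n) ⟩
  𝒩 n h + p * φ h + φ h      ≡⟨ +-assoc (𝒩 n h) (p * φ h) (φ h) ⟩
  𝒩 n h + (p * φ h + φ h)    ≡⟨ cong (𝒩 n h +_) (+-comm (p * φ h) (φ h)) ⟩
  𝒩 n h + suc p * φ h        ∎
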